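{- Let $D$ be a nonzero integer, $P\in E_D(\mathbb{Q})\setminus\{\mathcal{O},T\}$, and let $a,z,w$ be the integers attached to $P$ as described in the context. Fix a square root $\sqrt{a}\in\overline{\mathbb{Q}}$ and a nonzero algebraic integer $\gamma$, and let $K=\mathbb{Q}(\sqrt{a},\gamma)$. Put \[ c_{4,a,z,w}^\gamma=-2^5\sqrt{a}\,(3w-5\sqrt{a}z^2)\gamma^2,\qquad \Delta_{a,z,w}^\gamma=-2^9\sqrt{a}^{\,3}(w-\sqrt{a}z^2)(w+\sqrt{a}z^2)^2\gamma^6 .\] Then no prime ideal $\mathfrak{p}$ of the ring of integers of $K$ with $\mathfrak{p}\nmid 2\gamma a$ divides both $c_{4,a,z,w}^\gamma$ and $\Delta_{a,z,w}^\gamma$.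
   Context: For a nonzero integer $D$ let $E_D:y^2=x^3+Dx$ over $\mathbb{Q}$, with point at infinity $\mathcal{O}$ and $2$-torsion point $T=(0,0)$. For $P\in E_D(\mathbb{Q})\setminus\{\mathcal{O},T\}$ put $\hat P=T-P$ and write $P=(A/B^2,\,C/B^3)$, $\hat P=(\hat A/\hat B^2,\,\hat C/\hat B^3)$ with integers satisfying $\gcd(AC,B)=\gcd(\hat A\hat C,\hat B)=1$, $B,\hat B>0$. Then $a:=A/\hat B^2$ and $\hat a:=\hat A/B^2$ are integers with $a\hat a=D$, $w:=C/(a\hat B)$ is an integer, and $w^2=a\hat B^4+\hat a B^4$. Set $z:=\hat B$. These are the quantities $c_4$ and $\Delta$ of the Weierstrass model $E_{a,z,w}^\gamma: Y^2=X^3+4\sqrt{a}z\gamma X^2+2(az^2+\sqrt{a}w)\gamma^2X$. -}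

module Defs where

open import Level using (0ℓ)
open import Data.Nat as ℕ using (ℕ; zero; suc)
open import Data.Integer as ℤ using (ℤ; +_; -[1+_])
open import Data.Integer.GCD as ℤG using ()
open import Data.Rational as ℚ using (ℚ)
open import Data.Product using (_×_)
open import Data.Sum using (_⊎_)
open import Relation.Nullary using (¬_)
open import Relation.Binary.PropositionalEquality using (_≡_)
open import Algebra.Bundles using (CommutativeRing)

-- The curve E_D : y² = x³ + D x over ℚ (affine points; 𝒪 is not affine)

⟦_⟧ : ℤ → ℚ
⟦ n ⟧ = n ℚ./ 1

OnCurve : ℤ → ℚ → ℚ → Set
OnCurve D x y = y ℚ.* y ≡ x ℚ.* x ℚ.* x ℚ.+ ⟦ D ⟧ ℚ.* x

IsT : ℚ → ℚ → Set
IsT x y = (x ≡ ℚ.0ℚ) × (y ≡ ℚ.0ℚ)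

-- (x̂ , ŷ) = T - P for P = (x , y) ∈ E_D(ℚ) \ {𝒪 , T}.
-- By the chord rule: -P = (x , -y); the line through T = (0,0) and -P is
-- Y = -(y/x) X, meeting E_D a third time at X = D/x, Y = -D y / x²;
-- hence T + (-P) = (D/x , D y / x²).  (x ≠ 0 since P ≠ T.)
-- We state it multiplicatively, which determines (x̂ , ŷ) uniquely when x ≠ 0.
IsTMinus : ℤ → ℚ → ℚ → ℚ → ℚ → Set
IsTMinus D x y x̂ ŷ = (x̂ ℚ.* x ≡ ⟦ D ⟧) × (ŷ ℚ.* (x ℚ.* x) ≡ ⟦ D ⟧ ℚ.* y)

IsRep : ℚ → ℚ → ℤ → ℤ → ℤ → Set
IsRep x y A B C =
  (ℤ.0ℤ ℤ.< B)
  × (ℤG.gcd (A ℤ.* C) B ≡ ℤ.1ℤ)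
  × (x ℚ.* ⟦ B ℤ.* B ⟧ ≡ ⟦ A ⟧)
  × (y ℚ.* ⟦ B ℤ.* B ℤ.* B ⟧ ≡ ⟦ C ⟧)

module _ (R : CommutativeRing 0ℓ 0ℓ) where
  open CommutativeRing R

  natCast : ℕ → Carrier
  natCast zero = 0#
  natCast (suc n) = 1# + natCast n

  intCast : ℤ → Carrier
  intCast (+ n) = natCast n
  intCast -[1+ n ] = - natCast (suc n)

  record IsPrimeIdeal (𝔭 : Carrier → Set) : Set where
    field
      resp    : ∀ {x y} → x ≈ y → 𝔭 x → 𝔭 y
      has-0   : 𝔭 0#
      closed+ : ∀ {x y} → 𝔭 x → 𝔭 y → 𝔭 (x + y)
      absorb  : ∀ r {x} → 𝔭 x → 𝔭 (r * x)
      proper  : ¬ 𝔭 1#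
      prime   : ∀ {x y} → 𝔭 (x * y) → 𝔭 x ⊎ 𝔭 y

  -- c₄ = -2⁵ √a (3w - 5 √a z²) γ²   (s stands for √a)
  c4 : ℤ → ℤ → ℤ → Carrier → Carrier → Carrier
  c4 a z w s γ =
    - (intCast (+ 32) * s * (intCast (+ 3) * intCast w - intCast (+ 5) * s * (intCast z * intCast z)) * (γ * γ))

  Δ : ℤ → ℤ → ℤ → Carrier → Carrier → Carrier
  Δ a z w s γ =
    - (intCast (+ 512) * (s * s * s)
        * (intCast w - s * (intCast z * intCast z))
        * ((intCast w + s * (intCast z * intCast z)) * (intCast w + s * (intCast z * intCast z)))
        * (γ * γ * γ * γ * γ * γ))

-- Suppose 𝔭 ∤ 2γa divides c₄ and Δ. Then 𝔭 ∤ √a, so 𝔭 contains v = 3w − 5√a z²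
-- and one of w ∓ √a z². From 2√a z² = 3(w − √a z²) − v, respectively
-- 8√a z² = 3(w + √a z²) − v, the ideal 𝔭 contains z = B̂ and then w. But the
-- chord rule for T − P gives Ĉ B = Â w, so 𝔭 contains Ĉ or B: the first clashes
-- with gcd(ÂĈ, B̂) = 1, the second (as C = a B̂ w) with gcd(AC, B) = 1.
module Submission where

open import Defs
open import Level using (0ℓ)
open import Data.Integer using (ℤ; +_; _*_)
open import Data.Rational using (ℚ)
open import Data.Product using (_×_)
open import Relation.Nullary using (¬_)
open import Relation.Binary.PropositionalEquality using (_≡_)
open import Algebra.Bundles using (CommutativeRing)

open import Data.Nat as ℕ using (zero; suc)
import Data.Nat.GCD as ℕG
import Data.Nat.Coprimality as Coprime
open import Data.Integer as ℤ using (-[1+_])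
import Data.Integer.Properties as ℤP
import Data.Integer.GCD as ℤG
open import Data.Sign as Sign using (Sign)
import Data.Rational as ℚ
import Data.Rational.Properties as ℚP
open import Data.Maybe using (Maybe; just; nothing)
open import Data.Product using (_,_)
open import Data.Sum using (_⊎_; inj₁; inj₂)
open import Data.Empty using (⊥-elim)
open import Relation.Nullary using (yes; no)
import Relation.Binary.PropositionalEquality as ≡
import Algebra.Properties.Ring as RingProperties
import Algebra.Properties.Semiring.Mult as SemiringMult
import Algebra.Properties.CommutativeSemigroup as CommutativeSemigroupProperties
open import Algebra.Solver.Ring.AlmostCommutativeRing
  using (_-Raw-AlmostCommutative⟶_; fromCommutativeRing)

module IntCast (R : CommutativeRing 0ℓ 0ℓ) where
  open CommutativeRing R renaming (_*_ to _·_)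
  open RingProperties ring using (-1*x≈-x; -‿involutive; -0#≈0#; -‿+-comm)
  open SemiringMult semiring using (×-homo-+; ×1-homo-*) renaming (_×_ to _×ₙ_)
  open CommutativeSemigroupProperties *-commutativeSemigroup using (interchange)
  open import Relation.Binary.Reasoning.Setoid setoid

  natCast≡×1# : ∀ n → natCast R n ≡ n ×ₙ 1#
  natCast≡×1# zero = ≡.refl
  natCast≡×1# (suc n) = ≡.cong (λ k → 1# + k) (natCast≡×1# n)

  natCast-+ : ∀ m n → natCast R (m ℕ.+ n) ≈ natCast R m + natCast R n
  natCast-+ m n rewrite natCast≡×1# (m ℕ.+ n) | natCast≡×1# m | natCast≡×1# n = ×-homo-+ 1# m n

  natCast-* : ∀ m n → natCast R (m ℕ.* n) ≈ natCast R m · natCast R n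
  natCast-* m n rewrite natCast≡×1# (m ℕ.* n) | natCast≡×1# m | natCast≡×1# n = ×1-homo-* m n

  signCast : Sign → Carrier
  signCast Sign.+ = 1#
  signCast Sign.- = - 1#

  signCast-* : ∀ σ τ → signCast (σ Sign.* τ) ≈ signCast σ · signCast τ
  signCast-* Sign.+ τ = sym (*-identityˡ _)
  signCast-* Sign.- Sign.+ = sym (*-identityʳ _)
  signCast-* Sign.- Sign.- = sym (trans (-1*x≈-x _) (-‿involutive _))

  intCast-◃ : ∀ σ n → intCast R (σ ℤ.◃ n) ≈ signCast σ · natCast R n
  intCast-◃ σ zero = sym (zeroʳ _)
  intCast-◃ Sign.+ (suc n) = sym (*-identityˡ _)
  intCast-◃ Sign.- (suc n) = sym (-1*x≈-x _)

  intCast≈sign*abs : ∀ i → intCast R i ≈ signCast (ℤ.sign i) · natCast R ℤ.∣ i ∣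
  intCast≈sign*abs i = trans (reflexive (≡.cong (intCast R) (≡.sym (ℤP.signᵢ◃∣i∣≡i i))))
                             (intCast-◃ (ℤ.sign i) ℤ.∣ i ∣)

  intCast-* : ∀ i j → intCast R (i ℤ.* j) ≈ intCast R i · intCast R j
  intCast-* i j = begin
    intCast R (i ℤ.* j)
      ≈⟨ intCast-◃ (σ Sign.* τ) (ℤ.∣ i ∣ ℕ.* ℤ.∣ j ∣) ⟩
    signCast (σ Sign.* τ) · natCast R (ℤ.∣ i ∣ ℕ.* ℤ.∣ j ∣)
      ≈⟨ *-cong (signCast-* σ τ) (natCast-* ℤ.∣ i ∣ ℤ.∣ j ∣) ⟩
    (signCast σ · signCast τ) · (natCast R ℤ.∣ i ∣ · natCast R ℤ.∣ j ∣)
      ≈⟨ interchange _ _ _ _ ⟩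
    (signCast σ · natCast R ℤ.∣ i ∣) · (signCast τ · natCast R ℤ.∣ j ∣)
      ≈⟨ sym (*-cong (intCast≈sign*abs i) (intCast≈sign*abs j)) ⟩
    intCast R i · intCast R j ∎
    where
    σ = ℤ.sign i
    τ = ℤ.sign j

  intCast-neg : ∀ i → intCast R (ℤ.- i) ≈ - intCast R i
  intCast-neg (+ zero) = sym -0#≈0#
  intCast-neg (+ suc n) = refl
  intCast-neg -[1+ n ] = sym (-‿involutive _)

  intCast-⊖ : ∀ m n → intCast R (m ℤ.⊖ n) ≈ natCast R m - natCast R n
  intCast-⊖ m zero = sym (trans (+-congˡ -0#≈0#) (+-identityʳ _))
  intCast-⊖ zero (suc n) = sym (+-identityˡ _)
  intCast-⊖ (suc m) (suc n) = begin
    intCast R (suc m ℤ.⊖ suc n)         ≡⟨ ≡.cong (intCast R) (ℤP.[1+m]⊖[1+n]≡m⊖n m n) ⟩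
    intCast R (m ℤ.⊖ n)                 ≈⟨ intCast-⊖ m n ⟩
    M - N                               ≈⟨ sym (+-identityˡ _) ⟩
    0# + (M - N)                        ≈⟨ +-congʳ (sym (-‿inverseʳ 1#)) ⟩
    (1# - 1#) + (M - N)                 ≈⟨ interchange+ 1# (- 1#) M (- N) ⟩
    (1# + M) + (- 1# - N)               ≈⟨ +-congˡ (-‿+-comm 1# N) ⟩
    (1# + M) - (1# + N)                 ∎
    where
    open CommutativeSemigroupProperties +-commutativeSemigroup
      renaming (interchange to interchange+)
    M = natCast R m
    N = natCast R n

  intCast-+ : ∀ i j → intCast R (i ℤ.+ j) ≈ intCast R i + intCast R j
  intCast-+ (+ m) (+ n) = natCast-+ m n
  intCast-+ (+ m) -[1+ n ] = intCast-⊖ m (suc n)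
  intCast-+ -[1+ m ] (+ n) = trans (intCast-⊖ n (suc m)) (+-comm _ _)
  intCast-+ -[1+ m ] -[1+ n ] = begin
    - natCast R (suc (suc (m ℕ.+ n)))   ≡⟨ ≡.cong (λ k → - natCast R (suc k)) (≡.sym (ℕP.+-suc m n)) ⟩
    - natCast R (suc m ℕ.+ suc n)       ≈⟨ -‿cong (natCast-+ (suc m) (suc n)) ⟩
    - (natCast R (suc m) + natCast R (suc n)) ≈⟨ sym (-‿+-comm _ _) ⟩
    - natCast R (suc m) - natCast R (suc n) ∎
    where import Data.Nat.Properties as ℕP

  intCast-morphism : ℤ.+-*-rawRing -Raw-AlmostCommutative⟶ fromCommutativeRing R
  intCast-morphism = record
    { ⟦_⟧ = intCast R ; +-homo = intCast-+ ; *-homo = intCast-* ; -‿homo = intCast-neg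
    ; 0-homo = refl ; 1-homo = +-identityʳ 1# }

  intCast-≟ : ∀ i j → Maybe (intCast R i ≈ intCast R j)
  intCast-≟ i j with i ℤP.≟ j
  ... | yes ≡.refl = just refl
  ... | no _ = nothing

  open import Algebra.Solver.Ring ℤ.+-*-rawRing (fromCommutativeRing R) intCast-morphism intCast-≟
    using (solve; _:=_; _:+_; _:-_; _:*_; con) public

module PrimeIdeal (R : CommutativeRing 0ℓ 0ℓ) (𝔭 : CommutativeRing.Carrier R → Set)
                  (isPrime : IsPrimeIdeal R 𝔭) where
  open CommutativeRing R renaming (_*_ to _·_)
  open IsPrimeIdeal isPrime
  open RingProperties ring using (-1*x≈-x; -‿involutive)
  open IntCast R using (natCast-*; intCast-*)
  open import Relation.Binary.Reasoning.Setoid setoid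

  ∈-neg : ∀ {x} → 𝔭 x → 𝔭 (- x)
  ∈-neg {x} x∈ = resp (-1*x≈-x x) (absorb (- 1#) x∈)

  ∈-neg⁻¹ : ∀ {x} → 𝔭 (- x) → 𝔭 x
  ∈-neg⁻¹ {x} -x∈ = resp (-‿involutive x) (∈-neg -x∈)

  ∈-sub : ∀ {x y} → 𝔭 x → 𝔭 y → 𝔭 (x - y)
  ∈-sub x∈ y∈ = closed+ x∈ (∈-neg y∈)

  ∈-+-cancelʳ : ∀ {x y} → 𝔭 (x + y) → 𝔭 y → 𝔭 x
  ∈-+-cancelʳ {x} {y} x+y∈ y∈ = resp x+y-y≈x (∈-sub x+y∈ y∈)
    where
    x+y-y≈x : (x + y) - y ≈ x
    x+y-y≈x = begin
      (x + y) - y   ≈⟨ +-assoc x y (- y) ⟩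
      x + (y - y)   ≈⟨ +-congˡ (-‿inverseʳ y) ⟩
      x + 0#        ≈⟨ +-identityʳ x ⟩
      x             ∎

  absorbʳ : ∀ {x} r → 𝔭 x → 𝔭 (x · r)
  absorbʳ {x} r x∈ = resp (*-comm r x) (absorb r x∈)

  ∉-* : ∀ {x y} → ¬ 𝔭 x → ¬ 𝔭 y → ¬ 𝔭 (x · y)
  ∉-* x∉ y∉ xy∈ with prime xy∈
  ... | inj₁ x∈ = x∉ x∈
  ... | inj₂ y∈ = y∉ y∈

  ∈-*-cancelˡ : ∀ {x y} → ¬ 𝔭 x → 𝔭 (x · y) → 𝔭 y
  ∈-*-cancelˡ x∉ xy∈ with prime xy∈
  ... | inj₁ x∈ = ⊥-elim (x∉ x∈)
  ... | inj₂ y∈ = y∈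

  ∈-*-cancelʳ : ∀ {x y} → ¬ 𝔭 y → 𝔭 (x · y) → 𝔭 x
  ∈-*-cancelʳ y∉ xy∈ with prime xy∈
  ... | inj₁ x∈ = x∈
  ... | inj₂ y∈ = ⊥-elim (y∉ y∈)

  ∈-square : ∀ {x} → 𝔭 (x · x) → 𝔭 x
  ∈-square xx∈ with prime xx∈
  ... | inj₁ x∈ = x∈
  ... | inj₂ x∈ = x∈

  ∉-natCast-2^ : ¬ 𝔭 (natCast R 2) → ∀ k → ¬ 𝔭 (natCast R (2 ℕ.^ k))
  ∉-natCast-2^ 2∉ zero = λ 1∈ → proper (resp (+-identityʳ 1#) 1∈)
  ∉-natCast-2^ 2∉ (suc k) = λ 2^[1+k]∈ →
    ∉-* 2∉ (∉-natCast-2^ 2∉ k) (resp (natCast-* 2 (2 ℕ.^ k)) 2^[1+k]∈)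

  ∈-natCast-* : ∀ k n → 𝔭 (natCast R n) → 𝔭 (natCast R (k ℕ.* n))
  ∈-natCast-* k n n∈ = resp (sym (natCast-* k n)) (absorb (natCast R k) n∈)

  ∉-natCast-coprime : ∀ m n → ℕG.gcd m n ≡ 1 → 𝔭 (natCast R m) → ¬ 𝔭 (natCast R n)
  ∉-natCast-coprime m n gcd≡1 m∈ n∈ with Coprime.coprime-Bézout (Coprime.gcd≡1⇒coprime gcd≡1)
  ... | ℕG.Bézout.+- x y 1+yn≡xm =
    proper (∈-+-cancelʳ (≡.subst (λ k → 𝔭 (natCast R k)) (≡.sym 1+yn≡xm) (∈-natCast-* x m m∈)) (∈-natCast-* y n n∈))
  ... | ℕG.Bézout.-+ x y 1+xm≡yn =
    proper (∈-+-cancelʳ (≡.subst (λ k → 𝔭 (natCast R k)) (≡.sym 1+xm≡yn) (∈-natCast-* y n n∈)) (∈-natCast-* x m m∈))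

  ∈-intCast⇒∈-natCast-abs : ∀ i → 𝔭 (intCast R i) → 𝔭 (natCast R ℤ.∣ i ∣)
  ∈-intCast⇒∈-natCast-abs (+ n) n∈ = n∈
  ∈-intCast⇒∈-natCast-abs -[1+ n ] -n∈ = ∈-neg⁻¹ -n∈

  ∉-intCast-coprime : ∀ i j → ℤG.gcd i j ≡ ℤ.1ℤ → 𝔭 (intCast R i) → ¬ 𝔭 (intCast R j)
  ∉-intCast-coprime i j gcd≡1 i∈ j∈ =
    ∉-natCast-coprime ℤ.∣ i ∣ ℤ.∣ j ∣ (≡.cong ℤ.∣_∣ gcd≡1)
      (∈-intCast⇒∈-natCast-abs i i∈) (∈-intCast⇒∈-natCast-abs j j∈)

  ∈-intCast-*ˡ : ∀ i {j} → 𝔭 (intCast R j) → 𝔭 (intCast R (i * j))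
  ∈-intCast-*ˡ i {j} j∈ = resp (sym (intCast-* i j)) (absorb (intCast R i) j∈)

  w∈𝔭⇒B̂∉𝔭 : ∀ A B C Â B̂ Ĉ a w → ℤG.gcd (A * C) B ≡ ℤ.1ℤ → ℤG.gcd (Â * Ĉ) B̂ ≡ ℤ.1ℤ →
             C ≡ a * B̂ * w → Ĉ * B ≡ Â * w → 𝔭 (intCast R w) → ¬ 𝔭 (intCast R B̂)
  w∈𝔭⇒B̂∉𝔭 A B C Â B̂ Ĉ a w gcd[AC,B]≡1 gcd[ÂĈ,B̂]≡1 C≡aB̂w ĈB≡Âw w∈ B̂∈
    with prime (resp (intCast-* Ĉ B) ĈB∈)
    where
    ĈB∈ : 𝔭 (intCast R (Ĉ * B))
    ĈB∈ = ≡.subst (λ k → 𝔭 (intCast R k)) (≡.sym ĈB≡Âw) (∈-intCast-*ˡ Â w∈)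
  ... | inj₁ Ĉ∈ = ∉-intCast-coprime (Â * Ĉ) B̂ gcd[ÂĈ,B̂]≡1 (∈-intCast-*ˡ Â Ĉ∈) B̂∈
  ... | inj₂ B∈ = ∉-intCast-coprime (A * C) B gcd[AC,B]≡1 (∈-intCast-*ˡ A C∈) B∈
    where
    C∈ : 𝔭 (intCast R C)
    C∈ = ≡.subst (λ k → 𝔭 (intCast R k)) (≡.sym C≡aB̂w) (∈-intCast-*ˡ (a * B̂) w∈)

module CommonPrimeDivisor
  (R : CommutativeRing 0ℓ 0ℓ) (𝔭 : CommutativeRing.Carrier R → Set) (isPrime : IsPrimeIdeal R 𝔭)
  (a z w : ℤ) (s γ : CommutativeRing.Carrier R)
  (s²≈a : CommutativeRing._≈_ R (CommutativeRing._*_ R s s) (intCast R a))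
  (2γa∉𝔭 : ¬ 𝔭 (CommutativeRing._*_ R (CommutativeRing._*_ R (intCast R (+ 2)) γ) (intCast R a)))
  where
  open CommutativeRing R renaming (_*_ to _·_)
  open IsPrimeIdeal isPrime
  open IntCast R using (solve; _:=_; _:+_; _:-_; _:*_; con)
  open PrimeIdeal R 𝔭 isPrime

  2∉𝔭 : ¬ 𝔭 (intCast R (+ 2))
  2∉𝔭 2∈ = 2γa∉𝔭 (absorbʳ (intCast R a) (absorbʳ γ 2∈))

  γ∉𝔭 : ¬ 𝔭 γ
  γ∉𝔭 γ∈ = 2γa∉𝔭 (absorbʳ (intCast R a) (absorb (intCast R (+ 2)) γ∈))

  s∉𝔭 : ¬ 𝔭 s
  s∉𝔭 s∈ = 2γa∉𝔭 (absorb (intCast R (+ 2) · γ) (resp s²≈a (absorbʳ s s∈)))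

  2^∉𝔭 : ∀ k → ¬ 𝔭 (intCast R (+ (2 ℕ.^ k)))
  2^∉𝔭 = ∉-natCast-2^ 2∉𝔭

  √az² : Carrier
  √az² = s · (intCast R z · intCast R z)

  v : Carrier
  v = intCast R (+ 3) · intCast R w - intCast R (+ 5) · s · (intCast R z · intCast R z)

  v∈𝔭 : 𝔭 (c4 R a z w s γ) → 𝔭 v
  v∈𝔭 c4∈ = ∈-*-cancelˡ (∉-* (2^∉𝔭 5) s∉𝔭) (∈-*-cancelʳ (∉-* γ∉𝔭 γ∉𝔭) (∈-neg⁻¹ c4∈))

  w∓√az²∈𝔭 : 𝔭 (Δ R a z w s γ) → 𝔭 (intCast R w - √az²) ⊎ 𝔭 (intCast R w + √az²)
  w∓√az²∈𝔭 Δ∈ with prime (∈-*-cancelʳ γ⁶∉𝔭 (∈-neg⁻¹ Δ∈))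
    where
    γ⁶∉𝔭 : ¬ 𝔭 (γ · γ · γ · γ · γ · γ)
    γ⁶∉𝔭 = ∉-* (∉-* (∉-* (∉-* (∉-* γ∉𝔭 γ∉𝔭) γ∉𝔭) γ∉𝔭) γ∉𝔭) γ∉𝔭
  ... | inj₁ 512s³u∈ = inj₁ (∈-*-cancelˡ (∉-* (2^∉𝔭 9) (∉-* (∉-* s∉𝔭 s∉𝔭) s∉𝔭)) 512s³u∈)
  ... | inj₂ u′²∈ = inj₂ (∈-square u′²∈)

  z∈𝔭 : ∀ {k t} → ¬ 𝔭 k → k · √az² ≈ intCast R (+ 3) · t - v → 𝔭 t → 𝔭 v → 𝔭 (intCast R z)
  z∈𝔭 k∉ k√az²≈3t-v t∈ v∈ =
    ∈-square (∈-*-cancelˡ s∉𝔭 (∈-*-cancelˡ k∉ (resp (sym k√az²≈3t-v) (∈-sub (absorb (intCast R (+ 3)) t∈) v∈))))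

  √az²∈𝔭 : 𝔭 (intCast R z) → 𝔭 √az²
  √az²∈𝔭 z∈ = absorb s (absorb (intCast R z) z∈)

  w∈𝔭×z∈𝔭 : 𝔭 (c4 R a z w s γ) → 𝔭 (Δ R a z w s γ) → 𝔭 (intCast R w) × 𝔭 (intCast R z)
  w∈𝔭×z∈𝔭 c4∈ Δ∈ with w∓√az²∈𝔭 Δ∈
  ... | inj₁ w-√az²∈ = resp (solve 2 (λ w t → (w :- t) :+ t := w) refl _ _) (closed+ w-√az²∈ (√az²∈𝔭 z∈)) , z∈
    where
    z∈ : 𝔭 (intCast R z)
    z∈ = z∈𝔭 2∉𝔭
      (solve 3 (λ w s z → con (+ 2) :* (s :* (z :* z))
                        := con (+ 3) :* (w :- s :* (z :* z)) :- (con (+ 3) :* w :- con (+ 5) :* s :* (z :* z)))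
             refl (intCast R w) s (intCast R z))
      w-√az²∈ (v∈𝔭 c4∈)
  ... | inj₂ w+√az²∈ = resp (solve 2 (λ w t → (w :+ t) :- t := w) refl _ _) (∈-sub w+√az²∈ (√az²∈𝔭 z∈)) , z∈
    where
    z∈ : 𝔭 (intCast R z)
    z∈ = z∈𝔭 (2^∉𝔭 3)
      (solve 3 (λ w s z → con (+ 8) :* (s :* (z :* z))
                        := con (+ 3) :* (w :+ s :* (z :* z)) :- (con (+ 3) :* w :- con (+ 5) :* s :* (z :* z)))
             refl (intCast R w) s (intCast R z))
      w+√az²∈ (v∈𝔭 c4∈)

module RationalPoints where
  open ≡ using (cong; cong₂; sym; trans)
  open ≡.≡-Reasoning
  open IntCast ℚP.+-*-commutativeRing using (solve; _:=_; _:*_)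

  ⟦⟧≡mkℚ : ∀ i → ⟦ i ⟧ ≡ ℚ.mkℚ i 0 (Coprime.sym (Coprime.1-coprimeTo ℤ.∣ i ∣))
  ⟦⟧≡mkℚ i = ℚP.↥p/↧p≡p (ℚ.mkℚ i 0 (Coprime.sym (Coprime.1-coprimeTo ℤ.∣ i ∣)))

  ⟦⟧-* : ∀ i j → ⟦ i * j ⟧ ≡ ⟦ i ⟧ ℚ.* ⟦ j ⟧
  ⟦⟧-* i j rewrite ⟦⟧≡mkℚ i | ⟦⟧≡mkℚ j = ≡.refl

  ⟦⟧-injective : ∀ {i j} → ⟦ i ⟧ ≡ ⟦ j ⟧ → i ≡ j
  ⟦⟧-injective {i} {j} ⟦i⟧≡⟦j⟧ rewrite ⟦⟧≡mkℚ i | ⟦⟧≡mkℚ j = cong ℚ.↥_ ⟦i⟧≡⟦j⟧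

  ⟦⟧-³ : ∀ i → ⟦ i * i * i ⟧ ≡ ⟦ i ⟧ ℚ.* ⟦ i ⟧ ℚ.* ⟦ i ⟧
  ⟦⟧-³ i = trans (⟦⟧-* (i * i) i) (cong (ℚ._* ⟦ i ⟧) (⟦⟧-* i i))

  *-≢0 : ∀ {i j} → ¬ i ≡ + 0 → ¬ j ≡ + 0 → ¬ i * j ≡ + 0
  *-≢0 {i} i≢0 j≢0 ij≡0 with ℤP.i*j≡0⇒i≡0∨j≡0 i ij≡0
  ... | inj₁ i≡0 = i≢0 i≡0
  ... | inj₂ j≡0 = j≢0 j≡0

  -- With x = A/B², y = C/B³, A = a B̂², C = a B̂ w and x̂ = Â/B̂², ŷ = Ĉ/B̂³, this is Ĉ B A² = Â w A².
  chord-relation : ∀ (x y x̂ ŷ b b̂ a w : ℚ) →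
    ŷ ℚ.* (x ℚ.* x) ≡ x̂ ℚ.* x ℚ.* y →
    x ℚ.* (b ℚ.* b) ≡ a ℚ.* (b̂ ℚ.* b̂) →
    y ℚ.* (b ℚ.* b ℚ.* b) ≡ a ℚ.* b̂ ℚ.* w →
    ŷ ℚ.* (b̂ ℚ.* b̂ ℚ.* b̂) ℚ.* b ℚ.* (x ℚ.* (b ℚ.* b) ℚ.* (x ℚ.* (b ℚ.* b)))
      ≡ x̂ ℚ.* (b̂ ℚ.* b̂) ℚ.* w ℚ.* (x ℚ.* (b ℚ.* b) ℚ.* (x ℚ.* (b ℚ.* b)))
  chord-relation x y x̂ ŷ b b̂ a w ŷx²≡x̂xy xb²≡ab̂² yb³≡ab̂w = begin
    ŷ ℚ.* (b̂ ℚ.* b̂ ℚ.* b̂) ℚ.* b ℚ.* (x ℚ.* (b ℚ.* b) ℚ.* (x ℚ.* (b ℚ.* b)))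
      ≡⟨ solve 4 (λ x ŷ b b̂ → ŷ :* (b̂ :* b̂ :* b̂) :* b :* (x :* (b :* b) :* (x :* (b :* b)))
                            := ŷ :* (x :* x) :* (b :* b :* b) :* (b̂ :* b̂ :* b̂) :* (b :* b)) ≡.refl x ŷ b b̂ ⟩
    ŷ ℚ.* (x ℚ.* x) ℚ.* (b ℚ.* b ℚ.* b) ℚ.* (b̂ ℚ.* b̂ ℚ.* b̂) ℚ.* (b ℚ.* b)
      ≡⟨ cong (λ t → t ℚ.* (b ℚ.* b ℚ.* b) ℚ.* (b̂ ℚ.* b̂ ℚ.* b̂) ℚ.* (b ℚ.* b)) ŷx²≡x̂xy ⟩
    x̂ ℚ.* x ℚ.* y ℚ.* (b ℚ.* b ℚ.* b) ℚ.* (b̂ ℚ.* b̂ ℚ.* b̂) ℚ.* (b ℚ.* b)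
      ≡⟨ solve 5 (λ x y x̂ b b̂ → x̂ :* x :* y :* (b :* b :* b) :* (b̂ :* b̂ :* b̂) :* (b :* b)
                              := x̂ :* (b̂ :* b̂) :* (x :* (b :* b)) :* (y :* (b :* b :* b)) :* b̂) ≡.refl x y x̂ b b̂ ⟩
    x̂ ℚ.* (b̂ ℚ.* b̂) ℚ.* (x ℚ.* (b ℚ.* b)) ℚ.* (y ℚ.* (b ℚ.* b ℚ.* b)) ℚ.* b̂
      ≡⟨ cong (λ t → x̂ ℚ.* (b̂ ℚ.* b̂) ℚ.* (x ℚ.* (b ℚ.* b)) ℚ.* t ℚ.* b̂) yb³≡ab̂w ⟩
    x̂ ℚ.* (b̂ ℚ.* b̂) ℚ.* (x ℚ.* (b ℚ.* b)) ℚ.* (a ℚ.* b̂ ℚ.* w) ℚ.* b̂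
      ≡⟨ solve 6 (λ x̂ b̂ X a w b → x̂ :* (b̂ :* b̂) :* X :* (a :* b̂ :* w) :* b̂
                                := x̂ :* (b̂ :* b̂) :* w :* (X :* (a :* (b̂ :* b̂)))) ≡.refl x̂ b̂ (x ℚ.* (b ℚ.* b)) a w b ⟩
    x̂ ℚ.* (b̂ ℚ.* b̂) ℚ.* w ℚ.* (x ℚ.* (b ℚ.* b) ℚ.* (a ℚ.* (b̂ ℚ.* b̂)))
      ≡⟨ cong (λ t → x̂ ℚ.* (b̂ ℚ.* b̂) ℚ.* w ℚ.* (x ℚ.* (b ℚ.* b) ℚ.* t)) (sym xb²≡ab̂²) ⟩
    x̂ ℚ.* (b̂ ℚ.* b̂) ℚ.* w ℚ.* (x ℚ.* (b ℚ.* b) ℚ.* (x ℚ.* (b ℚ.* b))) ∎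

  ⟦⟧-*⁴ : ∀ i j k l → ⟦ i * j * (k * l) ⟧ ≡ ⟦ i ⟧ ℚ.* ⟦ j ⟧ ℚ.* (⟦ k ⟧ ℚ.* ⟦ l ⟧)
  ⟦⟧-*⁴ i j k l = trans (⟦⟧-* (i * j) (k * l)) (cong₂ ℚ._*_ (⟦⟧-* i j) (⟦⟧-* k l))

  numerator≢0 : ∀ {D x x̂ A B} → ¬ D ≡ + 0 → x̂ ℚ.* x ≡ ⟦ D ⟧ → ℤ.0ℤ ℤ.< B →
                x ℚ.* ⟦ B * B ⟧ ≡ ⟦ A ⟧ → ¬ A ≡ + 0
  numerator≢0 {D} {x} {x̂} {A} {B} D≢0 x̂x≡D 0<B xB²≡A A≡0 =
    *-≢0 D≢0 (*-≢0 B≢0 B≢0) (⟦⟧-injective (begin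
      ⟦ D * (B * B) ⟧          ≡⟨ ⟦⟧-* D (B * B) ⟩
      ⟦ D ⟧ ℚ.* ⟦ B * B ⟧      ≡⟨ cong (ℚ._* ⟦ B * B ⟧) (sym x̂x≡D) ⟩
      x̂ ℚ.* x ℚ.* ⟦ B * B ⟧    ≡⟨ ℚP.*-assoc x̂ x ⟦ B * B ⟧ ⟩
      x̂ ℚ.* (x ℚ.* ⟦ B * B ⟧)  ≡⟨ cong (x̂ ℚ.*_) (trans xB²≡A (cong ⟦_⟧ A≡0)) ⟩
      x̂ ℚ.* ⟦ + 0 ⟧            ≡⟨ ℚP.*-zeroʳ x̂ ⟩
      ⟦ + 0 ⟧                  ∎))
    where
    B≢0 : ¬ B ≡ + 0
    B≢0 B≡0 = ℤP.<-irrefl (sym B≡0) 0<B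

  Ĉ*B≡Â*w : ∀ D x y x̂ ŷ A B C Â B̂ Ĉ a w → ¬ D ≡ + 0 → IsTMinus D x y x̂ ŷ →
            IsRep x y A B C → IsRep x̂ ŷ Â B̂ Ĉ → A ≡ a * (B̂ * B̂) → C ≡ a * B̂ * w →
            Ĉ * B ≡ Â * w
  Ĉ*B≡Â*w D x y x̂ ŷ A B C Â B̂ Ĉ a w D≢0 (x̂x≡D , ŷx²≡Dy)
          (0<B , _ , xB²≡A , yB³≡C) (_ , _ , x̂B̂²≡Â , ŷB̂³≡Ĉ) A≡aB̂² C≡aB̂w =
    ℤP.*-cancelʳ-≡ (Ĉ * B) (Â * w) (A * A) {{ℤ.≢-nonZero (*-≢0 A≢0 A≢0)}} (⟦⟧-injective (begin
      ⟦ Ĉ * B * (A * A) ⟧                      ≡⟨ ⟦⟧-*⁴ Ĉ B A A ⟩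
      ⟦ Ĉ ⟧ ℚ.* b ℚ.* (⟦ A ⟧ ℚ.* ⟦ A ⟧)        ≡⟨ cong₂ (λ c α → c ℚ.* b ℚ.* (α ℚ.* α)) Ĉ≡ŷb̂³ A≡X ⟩
      ŷ ℚ.* (b̂ ℚ.* b̂ ℚ.* b̂) ℚ.* b ℚ.* (X ℚ.* X)
        ≡⟨ chord-relation x y x̂ ŷ b b̂ ⟦ a ⟧ ⟦ w ⟧ ŷx²≡x̂xy X≡ab̂² yb³≡ab̂w ⟩
      x̂ ℚ.* (b̂ ℚ.* b̂) ℚ.* ⟦ w ⟧ ℚ.* (X ℚ.* X) ≡⟨ cong₂ (λ c α → c ℚ.* ⟦ w ⟧ ℚ.* (α ℚ.* α)) (sym Â≡x̂b̂²) (sym A≡X) ⟩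
      ⟦ Â ⟧ ℚ.* ⟦ w ⟧ ℚ.* (⟦ A ⟧ ℚ.* ⟦ A ⟧)    ≡⟨ sym (⟦⟧-*⁴ Â w A A) ⟩
      ⟦ Â * w * (A * A) ⟧                      ∎))
    where
    b b̂ X : ℚ
    b = ⟦ B ⟧
    b̂ = ⟦ B̂ ⟧
    X = x ℚ.* (b ℚ.* b)
    A≢0 : ¬ A ≡ + 0
    A≢0 = numerator≢0 {x = x} {x̂ = x̂} D≢0 x̂x≡D 0<B xB²≡A
    A≡X : ⟦ A ⟧ ≡ X
    A≡X = trans (sym xB²≡A) (cong (x ℚ.*_) (⟦⟧-* B B))
    Â≡x̂b̂² : ⟦ Â ⟧ ≡ x̂ ℚ.* (b̂ ℚ.* b̂)
    Â≡x̂b̂² = trans (sym x̂B̂²≡Â) (cong (x̂ ℚ.*_) (⟦⟧-* B̂ B̂))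
    Ĉ≡ŷb̂³ : ⟦ Ĉ ⟧ ≡ ŷ ℚ.* (b̂ ℚ.* b̂ ℚ.* b̂)
    Ĉ≡ŷb̂³ = trans (sym ŷB̂³≡Ĉ) (cong (ŷ ℚ.*_) (⟦⟧-³ B̂))
    ŷx²≡x̂xy : ŷ ℚ.* (x ℚ.* x) ≡ x̂ ℚ.* x ℚ.* y
    ŷx²≡x̂xy = trans ŷx²≡Dy (cong (ℚ._* y) (sym x̂x≡D))
    X≡ab̂² : X ≡ ⟦ a ⟧ ℚ.* (b̂ ℚ.* b̂)
    X≡ab̂² = begin
      X                        ≡⟨ sym A≡X ⟩
      ⟦ A ⟧                    ≡⟨ cong ⟦_⟧ A≡aB̂² ⟩
      ⟦ a * (B̂ * B̂) ⟧          ≡⟨ ⟦⟧-* a (B̂ * B̂) ⟩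
      ⟦ a ⟧ ℚ.* ⟦ B̂ * B̂ ⟧      ≡⟨ cong (⟦ a ⟧ ℚ.*_) (⟦⟧-* B̂ B̂) ⟩
      ⟦ a ⟧ ℚ.* (b̂ ℚ.* b̂)      ∎
    yb³≡ab̂w : y ℚ.* (b ℚ.* b ℚ.* b) ≡ ⟦ a ⟧ ℚ.* b̂ ℚ.* ⟦ w ⟧
    yb³≡ab̂w = begin
      y ℚ.* (b ℚ.* b ℚ.* b)    ≡⟨ cong (y ℚ.*_) (sym (⟦⟧-³ B)) ⟩
      y ℚ.* ⟦ B * B * B ⟧      ≡⟨ yB³≡C ⟩
      ⟦ C ⟧                    ≡⟨ cong ⟦_⟧ C≡aB̂w ⟩
      ⟦ a * B̂ * w ⟧            ≡⟨ ⟦⟧-* (a * B̂) w ⟩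
      ⟦ a * B̂ ⟧ ℚ.* ⟦ w ⟧      ≡⟨ cong (ℚ._* ⟦ w ⟧) (⟦⟧-* a B̂) ⟩
      ⟦ a ⟧ ℚ.* b̂ ℚ.* ⟦ w ⟧    ∎

open RationalPoints using (Ĉ*B≡Â*w)

proposition2p1 : (D : ℤ) → ¬ (D ≡ + 0) →
    (x y : ℚ) → OnCurve D x y → ¬ IsT x y →
    (x̂ ŷ : ℚ) → IsTMinus D x y x̂ ŷ →
    (A B C Â B̂ Ĉ : ℤ) → IsRep x y A B C → IsRep x̂ ŷ Â B̂ Ĉ →
    (a w : ℤ) → A ≡ a * (B̂ * B̂) → C ≡ a * B̂ * w →
    (R : CommutativeRing 0ℓ 0ℓ) →
    (s γ : CommutativeRing.Carrier R) →
    CommutativeRing._≈_ R (CommutativeRing._*_ R s s) (intCast R a) →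
    ¬ CommutativeRing._≈_ R γ (CommutativeRing.0# R) →
    (𝔭 : CommutativeRing.Carrier R → Set) → IsPrimeIdeal R 𝔭 →
    ¬ 𝔭 (CommutativeRing._*_ R (CommutativeRing._*_ R (intCast R (+ 2)) γ) (intCast R a)) →
    ¬ (𝔭 (c4 R a B̂ w s γ) × 𝔭 (Δ R a B̂ w s γ))
proposition2p1 D D≢0 x y _ _ x̂ ŷ T−P A B C Â B̂ Ĉ rep@(_ , gcd[AC,B]≡1 , _) rep̂@(_ , gcd[ÂĈ,B̂]≡1 , _)
               a w A≡aB̂² C≡aB̂w R s γ s²≈a _ 𝔭 isPrime 2γa∉𝔭 (c4∈ , Δ∈) =
  let w∈ , B̂∈ = w∈𝔭×z∈𝔭 c4∈ Δ∈ in
  w∈𝔭⇒B̂∉𝔭 A B C Â B̂ Ĉ a w gcd[AC,B]≡1 gcd[ÂĈ,B̂]≡1 C≡aB̂w ĈB≡Âw w∈ B̂∈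
  where
  open PrimeIdeal R 𝔭 isPrime using (w∈𝔭⇒B̂∉𝔭)
  open CommonPrimeDivisor R 𝔭 isPrime a B̂ w s γ s²≈a 2γa∉𝔭 using (w∈𝔭×z∈𝔭)
  ĈB≡Âw : Ĉ * B ≡ Â * w
  ĈB≡Âw = Ĉ*B≡Â*w D x y x̂ ŷ A B C Â B̂ Ĉ a w D≢0 T−P rep rep̂ A≡aB̂² C≡aB̂w
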